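{- Let $\varphi\in\mathcal L$ and let $d_\varphi=\frac{\varphi:\ }{\bot}$ (prerequisite $\varphi$, empty set of justifications, consequent $\bot$). Let $E\subseteq\mathcal L$ be consistent and let $(D,W)$ be a default theory. Then $E$ is an extension of $(D\cup\{d_\varphi\},W)$ if and only if $\varphi\notin E$ and $E$ is an extension of $(D,W)$.
   Context: $\mathcal L$ is the set of formulas of a propositional language over a denumerable set of atoms; $Cn$ denotes propositional consequence, and a theory is a subset of $\mathcal L$ closed under $Cn$. A default is an expression $d=\frac{\alpha:\Gamma}{\beta}$ with $\alpha,\beta\in\mathcal L$ and $\Gamma$ a finite subset of $\mathcal L$; write $p(d)=\alpha$, $j(d)=\Gamma$, $c(d)=\beta$. A default theory is a pair $(D,W)$ with $D$ a set of defaults and $W\subseteq\mathcal L$. For a set $S$ of formulas, $d$ is $S$-applicable if $S\not\vdash\neg\gamma$ for every $\gamma\in j(d)$. The reduct $D_S$ is the set of monotone rules $\frac{p(d)}{c(d)}$ for $S$-applicable $d\in D$, and $Cn^{D_S}(W)$ is the set of formulas provable from $W$ in propositional calculus extended by the rules in $D_S$. A set $S$ is an extension of $(D,W)$ iff $S=Cn^{D_S}(W)$. -}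

module Defs where

open import Level using (0ℓ)
open import Data.Nat using (ℕ)
open import Data.List using (List; [])
open import Data.List.Membership.Propositional using () renaming (_∈_ to _∈ₗ_)
open import Data.Product using (Σ; _×_; _,_)
open import Relation.Nullary using (¬_)
open import Relation.Unary using (Pred; _∈_; _≐_; ∅)
open import Relation.Binary.PropositionalEquality using (_≡_)

-- Propositional language over the denumerable set of atoms ℕ.
-- Primitive connectives: ⊥ and ⇒ (functionally complete classically);
-- the other connectives are the usual abbreviations.
data Form : Set where
  atom : ℕ → Form
  ⊥′   : Form
  _⇒_  : Form → Form → Form

infixr 5 _⇒_

¬′_ : Form → Form
¬′ φ = φ ⇒ ⊥′

_∨′_ : Form → Form → Form
φ ∨′ ψ = (¬′ φ) ⇒ ψ

_∧′_ : Form → Form → Form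
φ ∧′ ψ = ¬′ (φ ⇒ ¬′ ψ)

FSet : Set₁
FSet = Pred Form 0ℓ

record Rule : Set where
  constructor _/_
  field
    prem : Form
    conc : Form

data _⊢[_]_ (W : FSet) (R : Pred Rule 0ℓ) : Form → Set where
  hyp : ∀ {φ} → φ ∈ W → W ⊢[ R ] φ
  axK : ∀ {φ ψ} → W ⊢[ R ] (φ ⇒ (ψ ⇒ φ))
  axS : ∀ {φ ψ χ} → W ⊢[ R ] ((φ ⇒ (ψ ⇒ χ)) ⇒ ((φ ⇒ ψ) ⇒ (φ ⇒ χ)))
  axDN : ∀ {φ} → W ⊢[ R ] (¬′ ¬′ φ ⇒ φ)
  mp  : ∀ {φ ψ} → W ⊢[ R ] (φ ⇒ ψ) → W ⊢[ R ] φ → W ⊢[ R ] ψ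
  rule : ∀ {α β} → (α / β) ∈ R → W ⊢[ R ] α → W ⊢[ R ] β

_⊢_ : FSet → Form → Set
S ⊢ φ = S ⊢[ ∅ ] φ

CnR : Pred Rule 0ℓ → FSet → FSet
CnR R W φ = W ⊢[ R ] φ

Consistent : FSet → Set
Consistent S = ¬ (S ⊢ ⊥′)

-- Defaults  α : Γ / β  with Γ a finite set (list) of justifications.
record Default : Set where
  constructor mkDefault
  field
    p : Form
    j : List Form
    c : Form
open Default public

DSet : Set₁
DSet = Pred Default 0ℓ

Applicable : FSet → Default → Set
Applicable S d = ∀ {γ} → γ ∈ₗ j d → ¬ (S ⊢ (¬′ γ))

Reduct : DSet → FSet → Pred Rule 0ℓ
Reduct D S r = Σ Default λ d → d ∈ D × Applicable S d × r ≡ (p d / c d)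

IsExtension : DSet → FSet → FSet → Set
IsExtension D W S = S ≐ CnR (Reduct D S) W

dBot : Form → Default
dBot φ = mkDefault φ [] ⊥′

-- Since d_φ has no justifications it lies in every reduct, as the rule φ / ⊥.
-- Hence in an extension E of (D ∪ {d_φ}, W), φ ∈ E would put ⊥ in E, so φ ∉ E
-- by consistency. And once φ is not derivable from W with the reduct of D,
-- the extra rule φ / ⊥ can never fire, so both reducts generate the same Cn^R(W):
-- the fixpoint equations for the two default theories coincide.
module Submission where

open import Defs
open import Data.Product using (_×_; _,_; proj₂)
open import Data.Sum using (_⊎_; inj₁; inj₂)
open import Function.Bundles using (_⇔_; mk⇔)
open import Level using (0ℓ)
open import Relation.Nullary using (contradiction)
open import Relation.Unary using (Pred; _∈_; _∉_; _⊆_; _≐_; _∪_; ｛_｝)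
open import Relation.Unary.Properties using (≐-sym; ≐-trans)
open import Relation.Binary.PropositionalEquality using (_≡_; refl)

private
  variable
    R R′ : Pred Rule 0ℓ
    W S : FSet
    D D′ : DSet
    φ : Form

CnR-mono : R ⊆ R′ → CnR R W ⊆ CnR R′ W
CnR-mono R⊆R′ (hyp φ∈W)    = hyp φ∈W
CnR-mono R⊆R′ axK          = axK
CnR-mono R⊆R′ axS          = axS
CnR-mono R⊆R′ axDN         = axDN
CnR-mono R⊆R′ (mp ⊢φ⇒ψ ⊢φ) = mp (CnR-mono R⊆R′ ⊢φ⇒ψ) (CnR-mono R⊆R′ ⊢φ)
CnR-mono R⊆R′ (rule r∈R ⊢α) = rule (R⊆R′ r∈R) (CnR-mono R⊆R′ ⊢α)

CnR-drop-blocked : (∀ {r} → r ∈ R′ → r ∈ R ⊎ Rule.prem r ≡ φ) →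
                   φ ∉ CnR R W → CnR R′ W ⊆ CnR R W
CnR-drop-blocked split φ∉ (hyp φ∈W)    = hyp φ∈W
CnR-drop-blocked split φ∉ axK          = axK
CnR-drop-blocked split φ∉ axS          = axS
CnR-drop-blocked split φ∉ axDN         = axDN
CnR-drop-blocked split φ∉ (mp ⊢φ⇒ψ ⊢φ) =
  mp (CnR-drop-blocked split φ∉ ⊢φ⇒ψ) (CnR-drop-blocked split φ∉ ⊢φ)
CnR-drop-blocked split φ∉ (rule r∈R′ ⊢α) with split r∈R′
... | inj₁ r∈R = rule r∈R (CnR-drop-blocked split φ∉ ⊢α)
... | inj₂ refl = contradiction (CnR-drop-blocked split φ∉ ⊢α) φ∉

Reduct-mono : D ⊆ D′ → Reduct D S ⊆ Reduct D′ S
Reduct-mono D⊆D′ (d , d∈D , app , refl) = d , D⊆D′ d∈D , app , refl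

dBot-applicable : Applicable S (dBot φ)
dBot-applicable ()

dBot∈Reduct : (φ / ⊥′) ∈ Reduct (D ∪ ｛ dBot φ ｝) S
dBot∈Reduct {φ = φ} = dBot φ , inj₂ refl , dBot-applicable {φ = φ} , refl

Reduct-∪-dBot-split : ∀ {r} → r ∈ Reduct (D ∪ ｛ dBot φ ｝) S →
                      r ∈ Reduct D S ⊎ Rule.prem r ≡ φ
Reduct-∪-dBot-split (d , inj₁ d∈D , app , refl) = inj₁ (d , d∈D , app , refl)
Reduct-∪-dBot-split (_ , inj₂ refl , _ , refl)  = inj₂ refl

CnR-Reduct-∪-dBot : φ ∉ CnR (Reduct D S) W →
                    CnR (Reduct (D ∪ ｛ dBot φ ｝) S) W ≐ CnR (Reduct D S) W
CnR-Reduct-∪-dBot φ∉ = CnR-drop-blocked Reduct-∪-dBot-split φ∉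
                     , CnR-mono (Reduct-mono inj₁)

extension-∪-dBot-excludes : {E : FSet} → Consistent E →
                            IsExtension (D ∪ ｛ dBot φ ｝) W E → φ ∉ E
extension-∪-dBot-excludes con (E⊆Cn , Cn⊆E) φ∈E =
  con (hyp (Cn⊆E (rule dBot∈Reduct (E⊆Cn φ∈E))))

mainTheorem6 : (φ : Form) (D : DSet) (W E : FSet) → Consistent E →
    (IsExtension (D ∪ ｛ dBot φ ｝) W E ⇔ (φ ∉ E × IsExtension D W E))
mainTheorem6 φ D W E con = mk⇔ forward backward
  where
  forward : IsExtension (D ∪ ｛ dBot φ ｝) W E → φ ∉ E × IsExtension D W E
  forward ext = φ∉E , ≐-trans ext (CnR-Reduct-∪-dBot φ∉CnD)
    where
    φ∉E : φ ∉ E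
    φ∉E = extension-∪-dBot-excludes con ext
    φ∉CnD : φ ∉ CnR (Reduct D E) W
    φ∉CnD ⊢φ = φ∉E (proj₂ ext (CnR-mono (Reduct-mono inj₁) ⊢φ))

  backward : φ ∉ E × IsExtension D W E → IsExtension (D ∪ ｛ dBot φ ｝) W E
  backward (φ∉E , ext) =
    ≐-trans ext (≐-sym (CnR-Reduct-∪-dBot (λ ⊢φ → φ∉E (proj₂ ext ⊢φ))))
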